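{- For every integer $n\ge 1$, $$\hat{B}_n(x_1,\dots,x_n)=F^{[n]}_{2n-1}(x_1,\dots,x_n).$$
   Context: For an integer $r\ge 1$, the $r$-Fibonacci polynomial $F^{[r]}_m(x_1,\dots,x_r)$ is defined by $F^{[r]}_m=0$ for $0\le m<r-1$, $F^{[r]}_{r-1}=1$, and $F^{[r]}_m=\sum_{i=1}^r x_iF^{[r]}_{m-i}$ for $m\ge r$. The partial ordinary Bell polynomial is $$\hat{B}_{n,k}=\sum_{\substack{j_1+j_2+\cdots+j_{n-k+1}=k\\ j_1+2j_2+\cdots+(n-k+1)j_{n-k+1}=n}}\frac{k!}{j_1!j_2!\cdots j_{n-k+1}!}x_1^{j_1}x_2^{j_2}\cdots x_{n-k+1}^{j_{n-k+1}}$$ (sum over nonnegative integers $j_i$), and the complete ordinary Bell polynomial is $\hat{B}_n=\sum_{k=1}^n\hat{B}_{n,k}$. -}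

module Defs where

open import Level using (Level)
open import Algebra.Bundles using (CommutativeSemiring)
open import Data.Nat as ℕ using (ℕ; zero; suc; _∸_; _<_; NonZero; _/_; _≟_; _<?_)
open import Data.Nat.Properties using (_!≢0; m*n≢0)
open import Data.Nat using (_!)
open import Data.List using (List; []; _∷_; concatMap; filter; map; foldr; upTo)
open import Data.Vec using (Vec; []; _∷_)
open import Data.Product using (_×_; _,_)
open import Relation.Binary.PropositionalEquality using (_≡_)
open import Relation.Nullary using (yes; no)
open import Relation.Nullary.Decidable using (_×-dec_)

vsum : ∀ {m} → Vec ℕ m → ℕ
vsum []       = 0
vsum (j ∷ js) = j ℕ.+ vsum js

wsumFrom : ∀ {m} → ℕ → Vec ℕ m → ℕ
wsumFrom s []       = 0
wsumFrom s (j ∷ js) = s ℕ.* j ℕ.+ wsumFrom (suc s) js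

prodFact : ∀ {m} → Vec ℕ m → ℕ
prodFact []       = 1
prodFact (j ∷ js) = j ! ℕ.* prodFact js

prodFact≢0 : ∀ {m} (js : Vec ℕ m) → NonZero (prodFact js)
prodFact≢0 []       = _
prodFact≢0 (j ∷ js) = m*n≢0 (j !) (prodFact js) {{j !≢0}} {{prodFact≢0 js}}

multinom : ∀ {m} → ℕ → Vec ℕ m → ℕ
multinom k js = (k !) / prodFact js
  where instance _ = prodFact≢0 js

-- all tuples (j₁,…,j_m) of naturals with every jᵢ ≤ b
-- (any nonnegative tuple with j₁+⋯+j_m = k has all jᵢ ≤ k, so b = k loses nothing)
tuples : (m b : ℕ) → List (Vec ℕ m)
tuples zero    b = [] ∷ []
tuples (suc m) b = concatMap (λ j → map (j ∷_) (tuples m b)) (upTo (suc b))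

bellIndex : (m n k : ℕ) → List (Vec ℕ m)
bellIndex m n k =
  filter (λ js → (vsum js ≟ k) ×-dec (wsumFrom 1 js ≟ n)) (tuples m k)

module Poly {c ℓ : Level} (R : CommutativeSemiring c ℓ) where
  open CommutativeSemiring R using (Carrier; _+_; _*_; 0#; 1#; rawSemiring)
  open import Algebra.Definitions.RawSemiring rawSemiring using (_^_) renaming (_×_ to _·_)

  -- A point (x₁, x₂, …) is given as x : ℕ → Carrier, with xᵢ = x i (1-based;
  -- x 0 is never used).

  Σ : List Carrier → Carrier
  Σ = foldr _+_ 0#

  monoFrom : ∀ {m} → (ℕ → Carrier) → ℕ → Vec ℕ m → Carrier
  monoFrom x s []       = 1#
  monoFrom x s (j ∷ js) = (x s ^ j) * monoFrom x (suc s) js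

  bellPartial : ℕ → ℕ → (ℕ → Carrier) → Carrier
  bellPartial n k x =
    Σ (map (λ js → multinom k js · monoFrom x 1 js) (bellIndex (suc (n ∸ k)) n k))

  bellComplete : ℕ → (ℕ → Carrier) → Carrier
  bellComplete n x = Σ (map (λ i → bellPartial n (suc i) x) (upTo n))

  private
    at : List Carrier → ℕ → Carrier
    at []       _       = 0#
    at (a ∷ as) zero    = a
    at (a ∷ as) (suc i) = at as i

    next : ℕ → (ℕ → Carrier) → ℕ → List Carrier → Carrier
    next r x m h with m <? r ∸ 1 | m ≟ r ∸ 1
    ... | yes _ | _     = 0#
    ... | no _  | yes _ = 1#
    ... | no _  | no _  = Σ (map (λ i → x (suc i) * at h i) (upTo r))

  hist : ℕ → (ℕ → Carrier) → ℕ → List Carrier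
  hist r x zero    = next r x zero [] ∷ []
  hist r x (suc m) = next r x (suc m) (hist r x m) ∷ hist r x m

  fib : ℕ → ℕ → (ℕ → Carrier) → Carrier
  fib r m x = at (hist r x m) 0

{-# OPTIONS --safe #-}
-- B̂_{n,k} is the coefficient of tⁿ in (x₁t + ⋯ + x_{n-k+1}t^{n-k+1})ᵏ: expand the power variable by variable,
-- each step being a binomial expansion. Adding the variables x_j with j > n-k+1 does not change that
-- coefficient, since they only reach degrees above n; so B̂_n = Σ_{k≤n} [tⁿ] Pᵏ with P = x₁t + ⋯ + xₙtⁿ.
-- The partial sums c_j = Σ_{k≤j} [tʲ] Pᵏ satisfy c₀ = 1 and c_j = Σ_{i=1}^n xᵢ c_{j-i} (with c = 0 at negative
-- indices), the recurrence of F^{[n]}_{n-1+j}; hence B̂_n = c_n = F^{[n]}_{2n-1}.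
module Submission where

open import Defs
open import Level using (Level)
open import Algebra.Bundles using (CommutativeSemiring)
open import Function using (_∘_)
open import Data.Nat as ℕ using (ℕ; zero; suc; _∸_; _≤_; _<_; _≥_; z≤n; s≤s; _≤?_; _≟_; _<?_; _!; NonZero)
import Data.Nat.Properties as ℕₚ
open import Data.Nat.Properties using (_!*_!≢0)
open import Data.Nat.Divisibility using (_∣_; divides; ∣-trans; *-monoʳ-∣)
open import Data.Nat.DivMod using (m*n/n≡m; /-congˡ)
open import Data.Nat.Combinatorics using (_C_; nCk≡n!/k![n-k]!; k![n∸k]!∣n!; k>n⇒nCk≡0; nCk+nC[k+1]≡[n+1]C[k+1])
open import Data.Nat.Solver using (module +-*-Solver)
open import Data.List using (List; []; _∷_; _++_; map; filter; concatMap; applyUpTo; upTo)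
open import Data.List.Properties using (map-++; map-∘)
open import Data.Vec using (Vec; []; _∷_)
open import Data.Product using (_×_; _,_)
open import Data.Nat.Induction using (<-rec)
open import Data.Empty using (⊥-elim)
open import Relation.Nullary using (Dec; yes; no; ¬_)
open import Relation.Nullary.Decidable using (_×-dec_)
open import Relation.Unary using (Decidable)
import Relation.Binary.PropositionalEquality as ≡
open ≡ using (_≡_)

prodFact∣vsum! : ∀ {m} (js : Vec ℕ m) → prodFact js ∣ vsum js !
prodFact∣vsum! []       = divides 1 ≡.refl
prodFact∣vsum! (j ∷ js) = ∣-trans (*-monoʳ-∣ (j !) (prodFact∣vsum! js))
  (≡.subst (λ v → j ! ℕ.* v ! ∣ (j ℕ.+ vsum js) !) (ℕₚ.m+n∸m≡n j (vsum js))
           (k![n∸k]!∣n! (ℕₚ.m≤m+n j (vsum js))))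

multinom-∷ : ∀ {m} k j (js : Vec ℕ m) → j ≤ k → vsum js ≡ k ∸ j →
             multinom k (j ∷ js) ≡ (k C j) ℕ.* multinom (k ∸ j) js
multinom-∷ k j js j≤k vsum≡ with prodFact∣vsum! js | k![n∸k]!∣n! j≤k
... | divides r [k∸j]!≡ | divides q k!≡ = begin
  k ! ℕ./ (j ! ℕ.* prodFact js)                               ≡⟨ /-congˡ k!≡′ ⟩
  q ℕ.* r ℕ.* (j ! ℕ.* prodFact js) ℕ./ (j ! ℕ.* prodFact js) ≡⟨ m*n/n≡m (q ℕ.* r) _ ⟩
  q ℕ.* r                                                     ≡⟨ ≡.cong₂ ℕ._*_ q≡kCj (≡.sym (m*n/n≡m r (prodFact js))) ⟩
  (k C j) ℕ.* (r ℕ.* prodFact js ℕ./ prodFact js)             ≡⟨ ≡.cong ((k C j) ℕ.*_) (/-congˡ (≡.sym r≡)) ⟩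
  (k C j) ℕ.* multinom (k ∸ j) js                             ∎
  where
  open ≡.≡-Reasoning
  open +-*-Solver
  instance
    _ : NonZero (j ! ℕ.* (k ∸ j) !)
    _ = j !* (k ∸ j) !≢0
    _ : NonZero (prodFact js)
    _ = prodFact≢0 js
    _ : NonZero (j ! ℕ.* prodFact js)
    _ = prodFact≢0 (j ∷ js)
  r≡ : (k ∸ j) ! ≡ r ℕ.* prodFact js
  r≡ = ≡.subst (λ v → v ! ≡ r ℕ.* prodFact js) vsum≡ [k∸j]!≡
  q≡kCj : q ≡ k C j
  q≡kCj = ≡.sym (≡.trans (nCk≡n!/k![n-k]! j≤k) (≡.trans (/-congˡ k!≡) (m*n/n≡m q _)))
  k!≡′ : k ! ≡ q ℕ.* r ℕ.* (j ! ℕ.* prodFact js)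
  k!≡′ = ≡.trans k!≡ (≡.trans (≡.cong (λ z → q ℕ.* (j ! ℕ.* z)) r≡)
           (solve 4 (λ a b c d → a :* (b :* (c :* d)) := (a :* c) :* (b :* d)) ≡.refl q (j !) r (prodFact js)))

∸-suc-< : ∀ {n k} t → suc t ≤ n → n < suc k → n ∸ suc t < k
∸-suc-< {n} t st≤n n<sk = ℕₚ.<-≤-trans (ℕₚ.∸-monoʳ-< {n} {suc t} {0} (s≤s z≤n) st≤n) (ℕₚ.≤-pred n<sk)

∸-<-+ : ∀ {n k m} → m ≤ n → n < k ℕ.+ m → n ∸ m < k
∸-<-+ {n} {k} {m} m≤n n<k+m = ℕₚ.+-cancelʳ-< m (n ∸ m) k (≡.subst (_< k ℕ.+ m) (≡.sym (ℕₚ.m∸n+n≡m m≤n)) n<k+m)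

module Sums {c ℓ : Level} (R : CommutativeSemiring c ℓ) where
  open CommutativeSemiring R hiding (zero)
  open Poly R using (Σ)
  open import Algebra.Definitions.RawSemiring rawSemiring using () renaming (_×_ to _·_)
  open import Algebra.Properties.CommutativeSemigroup +-commutativeSemigroup using (interchange)
  open import Algebra.Properties.CommutativeMonoid.Mult +-commutativeMonoid using (×-distrib-+)
  open import Algebra.Properties.Semiring.Mult semiring using (×-homo-+; ×-congʳ; ×-congˡ)
  open import Relation.Binary.Reasoning.Setoid setoid

  -- ∑ (like shift below) is opaque so that unification matches sums as wholes instead of unfolding
  -- them and the binomial coefficients inside them.
  opaque
    ∑ : ℕ → (ℕ → Carrier) → Carrier
    ∑ zero    f = 0#
    ∑ (suc N) f = f 0 + ∑ N (f ∘ suc)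

    ∑-suc : ∀ N (f : ℕ → Carrier) → ∑ (suc N) f ≈ f 0 + ∑ N (f ∘ suc)
    ∑-suc N f = refl

    ∑-one : ∀ (f : ℕ → Carrier) → ∑ 1 f ≈ f 0
    ∑-one f = +-identityʳ _

    ∑-cong : ∀ N {f g : ℕ → Carrier} → (∀ i → i < N → f i ≈ g i) → ∑ N f ≈ ∑ N g
    ∑-cong zero    f≈g = refl
    ∑-cong (suc N) f≈g = +-cong (f≈g 0 (s≤s z≤n)) (∑-cong N (λ i i<N → f≈g (suc i) (s≤s i<N)))

    ∑-zero : ∀ N {f : ℕ → Carrier} → (∀ i → i < N → f i ≈ 0#) → ∑ N f ≈ 0#
    ∑-zero zero    f≈0 = refl
    ∑-zero (suc N) f≈0 =
      trans (+-cong (f≈0 0 (s≤s z≤n)) (∑-zero N (λ i i<N → f≈0 (suc i) (s≤s i<N)))) (+-identityˡ 0#)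

    ∑-distrib-+ : ∀ N (f g : ℕ → Carrier) → ∑ N (λ i → f i + g i) ≈ ∑ N f + ∑ N g
    ∑-distrib-+ zero    f g = sym (+-identityˡ 0#)
    ∑-distrib-+ (suc N) f g = trans (+-congˡ (∑-distrib-+ N _ _)) (interchange _ _ _ _)

    ∑-homo : ∀ N (h : Carrier → Carrier) → h 0# ≈ 0# → (∀ u v → h (u + v) ≈ h u + h v) →
             ∀ f → h (∑ N f) ≈ ∑ N (h ∘ f)
    ∑-homo zero    h h0 h+ f = h0
    ∑-homo (suc N) h h0 h+ f = trans (h+ _ _) (+-congˡ (∑-homo N h h0 h+ _))

    ∑-comm : ∀ N M (f : ℕ → ℕ → Carrier) → ∑ N (λ i → ∑ M (f i)) ≈ ∑ M (λ j → ∑ N (λ i → f i j))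
    ∑-comm zero    M f = sym (∑-zero M (λ _ _ → refl))
    ∑-comm (suc N) M f = trans (+-congˡ (∑-comm N M _)) (sym (∑-distrib-+ M _ _))

    ∑-last : ∀ N (f : ℕ → Carrier) → ∑ (suc N) f ≈ ∑ N f + f N
    ∑-last zero    f = +-comm _ _
    ∑-last (suc N) f = trans (+-congˡ (∑-last N _)) (sym (+-assoc _ _ _))

    ∑-trailing-zeros : ∀ N K (f : ℕ → Carrier) → (∀ i → N ≤ i → f i ≈ 0#) → ∑ (N ℕ.+ K) f ≈ ∑ N f
    ∑-trailing-zeros zero    K f f≈0 = ∑-zero K (λ i _ → f≈0 i z≤n)
    ∑-trailing-zeros (suc N) K f f≈0 = +-congˡ (∑-trailing-zeros N K _ (λ i N≤i → f≈0 (suc i) (s≤s N≤i)))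

    Σ-map-applyUpTo : ∀ N (g : ℕ → ℕ) (f : ℕ → Carrier) → Σ (map f (applyUpTo g N)) ≈ ∑ N (f ∘ g)
    Σ-map-applyUpTo zero    g f = refl
    Σ-map-applyUpTo (suc N) g f = +-congˡ (Σ-map-applyUpTo N (g ∘ suc) f)

    Σ-map-upTo : ∀ N (f : ℕ → Carrier) → Σ (map f (upTo N)) ≈ ∑ N f
    Σ-map-upTo N = Σ-map-applyUpTo N (λ i → i)

  ∑-distribˡ-* : ∀ N a (f : ℕ → Carrier) → a * ∑ N f ≈ ∑ N (λ i → a * f i)
  ∑-distribˡ-* N a = ∑-homo N (a *_) (zeroʳ a) (distribˡ a)

  ×-zeroʳ : ∀ k → k · 0# ≈ 0#
  ×-zeroʳ zero    = refl
  ×-zeroʳ (suc k) = trans (+-identityˡ _) (×-zeroʳ k)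

  ∑-distribˡ-× : ∀ N k (f : ℕ → Carrier) → k · ∑ N f ≈ ∑ N (λ i → k · f i)
  ∑-distribˡ-× N k = ∑-homo N (k ·_) (×-zeroʳ k) (λ u v → ×-distrib-+ u v k)

  ∑-pascal : ∀ k (g : ℕ → Carrier) →
             ∑ (suc k) (λ a → (k C a) · g (suc a)) + ∑ (suc k) (λ a → (k C a) · g a)
             ≈ ∑ (suc (suc k)) (λ a → (suc k C a) · g a)
  ∑-pascal k g = begin
    ∑ (suc k) (λ a → (k C a) · g (suc a)) + ∑ (suc k) (λ a → (k C a) · g a)
      ≈⟨ +-congˡ (sym (trans (∑-last (suc k) (λ a → (k C a) · g a)) (trans (+-congˡ kCsk≈0) (+-identityʳ _)))) ⟩
    ∑ (suc k) (λ a → (k C a) · g (suc a)) + ∑ (suc (suc k)) (λ a → (k C a) · g a)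
      ≈⟨ +-congˡ (∑-suc (suc k) _) ⟩
    ∑ (suc k) (λ a → (k C a) · g (suc a)) + ((k C 0) · g 0 + ∑ (suc k) (λ a → (k C suc a) · g (suc a)))
      ≈⟨ trans (sym (+-assoc _ _ _)) (trans (+-congʳ (+-comm _ _)) (+-assoc _ _ _)) ⟩
    (k C 0) · g 0 + (∑ (suc k) (λ a → (k C a) · g (suc a)) + ∑ (suc k) (λ a → (k C suc a) · g (suc a)))
      ≈⟨ +-congˡ (sym (∑-distrib-+ (suc k) (λ a → (k C a) · g (suc a)) (λ a → (k C suc a) · g (suc a)))) ⟩
    (k C 0) · g 0 + ∑ (suc k) (λ a → (k C a) · g (suc a) + (k C suc a) · g (suc a))
      ≈⟨ +-congˡ (∑-cong (suc k) {g = λ a → (suc k C suc a) · g (suc a)} (λ a _ →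
           trans (sym (×-homo-+ _ (k C a) (k C suc a))) (×-congˡ (nCk+nC[k+1]≡[n+1]C[k+1] k a)))) ⟩
    (suc k C 0) · g 0 + ∑ (suc k) (λ a → (suc k C suc a) · g (suc a))
      ≈⟨ sym (∑-suc (suc k) _) ⟩
    ∑ (suc (suc k)) (λ a → (suc k C a) · g a) ∎
    where
    kCsk≈0 : (k C suc k) · g (suc k) ≈ 0#
    kCsk≈0 = ×-congˡ {g (suc k)} (k>n⇒nCk≡0 (ℕₚ.n<1+n k))

  when : ∀ {p} {A : Set p} → Dec A → Carrier → Carrier
  when (yes _) u = u
  when (no _)  u = 0#

  Σ-cong : ∀ {a} {A : Set a} {f g : A → Carrier} (l : List A) → (∀ e → f e ≈ g e) → Σ (map f l) ≈ Σ (map g l)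
  Σ-cong []      f≈g = refl
  Σ-cong (e ∷ l) f≈g = +-cong (f≈g e) (Σ-cong l f≈g)

  Σ-zero : ∀ {a} {A : Set a} {f : A → Carrier} (l : List A) → (∀ e → f e ≈ 0#) → Σ (map f l) ≈ 0#
  Σ-zero []      f≈0 = refl
  Σ-zero (e ∷ l) f≈0 = trans (+-cong (f≈0 e) (Σ-zero l f≈0)) (+-identityˡ _)

  Σ-homo : ∀ {a} {A : Set a} (h : Carrier → Carrier) → h 0# ≈ 0# → (∀ u v → h (u + v) ≈ h u + h v) →
           (f : A → Carrier) (l : List A) → h (Σ (map f l)) ≈ Σ (map (h ∘ f) l)
  Σ-homo h h0 h+ f []      = h0
  Σ-homo h h0 h+ f (e ∷ l) = trans (h+ _ _) (+-congˡ (Σ-homo h h0 h+ f l))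

  Σ-++ : ∀ (us vs : List Carrier) → Σ (us ++ vs) ≈ Σ us + Σ vs
  Σ-++ []       vs = sym (+-identityˡ _)
  Σ-++ (u ∷ us) vs = trans (+-congˡ (Σ-++ us vs)) (sym (+-assoc _ _ _))

  Σ-map-concatMap : ∀ {a b} {A : Set a} {B : Set b} (h : B → Carrier) (f : A → List B) (l : List A) →
                    Σ (map h (concatMap f l)) ≈ Σ (map (λ e → Σ (map h (f e))) l)
  Σ-map-concatMap h f []      = refl
  Σ-map-concatMap h f (e ∷ l) = trans (reflexive (≡.cong Σ (map-++ h (f e) (concatMap f l))))
    (trans (Σ-++ (map h (f e)) _) (+-congˡ (Σ-map-concatMap h f l)))

  Σ-map-filter : ∀ {a p} {A : Set a} {Q : A → Set p} (Q? : Decidable Q) (f : A → Carrier) (l : List A) →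
                 Σ (map f (filter Q? l)) ≈ Σ (map (λ e → when (Q? e) (f e)) l)
  Σ-map-filter Q? f [] = refl
  Σ-map-filter Q? f (e ∷ l) with Q? e
  ... | yes _ = +-congˡ (Σ-map-filter Q? f l)
  ... | no  _ = trans (Σ-map-filter Q? f l) (sym (+-identityˡ _))

  -- shift i f is the coefficient sequence of tⁱ times the series with coefficients f.
  opaque
    shift : ℕ → (ℕ → Carrier) → ℕ → Carrier
    shift i f n = when (i ≤? n) (f (n ∸ i))

    shift-≤ : ∀ {i n} f → i ≤ n → shift i f n ≈ f (n ∸ i)
    shift-≤ {i} {n} f i≤n with i ≤? n
    ... | yes _   = refl
    ... | no  i≰n = ⊥-elim (i≰n i≤n)

    shift-≰ : ∀ {i n} f → ¬ i ≤ n → shift i f n ≈ 0#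
    shift-≰ {i} {n} f i≰n with i ≤? n
    ... | yes i≤n = ⊥-elim (i≰n i≤n)
    ... | no  _   = refl

    shift-cong : ∀ i {f g : ℕ → Carrier} n → (i ≤ n → f (n ∸ i) ≈ g (n ∸ i)) → shift i f n ≈ shift i g n
    shift-cong i n f≈g with i ≤? n
    ... | yes i≤n = f≈g i≤n
    ... | no  _   = refl

    shift-≡ : ∀ {i j} f n → i ≡ j → shift i f n ≈ shift j f n
    shift-≡ f n ≡.refl = refl

    shift-zero : ∀ i n → shift i (λ _ → 0#) n ≈ 0#
    shift-zero i n with i ≤? n
    ... | yes _ = refl
    ... | no  _ = refl

    shift-homo : ∀ i (h : Carrier → Carrier) → h 0# ≈ 0# → ∀ f n → shift i (h ∘ f) n ≈ h (shift i f n)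
    shift-homo i h h0 f n with i ≤? n
    ... | yes _ = refl
    ... | no  _ = sym h0

    shift-∑ : ∀ i N (f : ℕ → ℕ → Carrier) n → shift i (λ m → ∑ N (λ a → f a m)) n ≈ ∑ N (λ a → shift i (f a) n)
    shift-∑ i N f n with i ≤? n
    ... | yes _ = refl
    ... | no  _ = sym (∑-zero N (λ _ _ → refl))

    shift-suc : ∀ i f n → shift (suc i) f (suc n) ≈ shift i f n
    shift-suc i f n with i ≤? n
    ... | yes i≤n = shift-≤ f (s≤s i≤n)
    ... | no  i≰n = shift-≰ f (i≰n ∘ ℕₚ.≤-pred)

    shift-+ : ∀ i j f n → shift i (shift j f) n ≈ shift (i ℕ.+ j) f n
    shift-+ i j f n with i ≤? n
    ... | no i≰n = sym (shift-≰ f (i≰n ∘ ℕₚ.≤-trans (ℕₚ.m≤m+n i j)))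
    ... | yes i≤n with j ≤? n ∸ i
    ...   | yes j≤n∸i = trans (reflexive (≡.cong f (ℕₚ.∸-+-assoc n i j))) (sym (shift-≤ f i+j≤n))
      where
      i+j≤n : i ℕ.+ j ≤ n
      i+j≤n = ≡.subst (i ℕ.+ j ≤_) (ℕₚ.m+[n∸m]≡n i≤n) (ℕₚ.+-monoʳ-≤ i j≤n∸i)
    ...   | no  j≰n∸i = sym (shift-≰ f (λ i+j≤n → j≰n∸i
        (≡.subst (_≤ n ∸ i) (ℕₚ.m+n∸m≡n i j) (ℕₚ.∸-monoˡ-≤ i i+j≤n))))

module PowerCoefficients {c ℓ : Level} (R : CommutativeSemiring c ℓ)
                         (x : ℕ → CommutativeSemiring.Carrier R) where
  open CommutativeSemiring R hiding (zero)
  open Poly R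
  open Sums R
  open import Algebra.Definitions.RawSemiring rawSemiring using (_^_) renaming (_×_ to _·_)
  open import Algebra.Properties.Semiring.Mult semiring using (×-assocˡ; ×-comm-*; ×-congʳ; ×-congˡ)
  open import Algebra.Properties.CommutativeMonoid.Mult +-commutativeMonoid using (×-distrib-+)
  open import Relation.Binary.Reasoning.Setoid setoid

  -- powCoeff s m k n is the coefficient of tⁿ in (x_s t^s + x_{s+1} t^{s+1} + ⋯ + x_{s+m-1} t^{s+m-1})ᵏ.
  powCoeff : ℕ → ℕ → ℕ → ℕ → Carrier
  powCoeff s m zero    n = when (n ≟ 0) 1#
  powCoeff s m (suc k) n = ∑ m (λ t → x (s ℕ.+ t) * shift (s ℕ.+ t) (powCoeff s m k) n)

  ×-*-zeroʳ : ∀ K p → K · (p * 0#) ≈ 0#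
  ×-*-zeroʳ K p = trans (×-congʳ K (zeroʳ p)) (×-zeroʳ K)

  *-×-*-comm : ∀ K p q z → q * (K · (p * z)) ≈ K · (p * (q * z))
  *-×-*-comm K p q z = trans (×-comm-* K q (p * z))
    (×-congʳ K (trans (sym (*-assoc q p z)) (trans (*-congʳ (*-comm q p)) (*-assoc p q z))))

  -- (x_s t^s + Q)ᵏ = Σₐ (k choose a) x_sᵃ t^{sa} Q^{k-a}, with Q = x_{s+1} t^{s+1} + ⋯ + x_{s+m} t^{s+m}.
  powCoeff-split : ∀ s m k n → powCoeff s (suc m) k n
                   ≈ ∑ (suc k) (λ a → (k C a) · (x s ^ a * shift (s ℕ.* a) (powCoeff (suc s) m (k ∸ a)) n))
  powCoeff-split s m zero n = sym (begin
    ∑ 1 (λ a → (0 C a) · (x s ^ a * shift (s ℕ.* a) (powCoeff (suc s) m (0 ∸ a)) n)) ≈⟨ ∑-one _ ⟩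
    1# * shift (s ℕ.* 0) (powCoeff (suc s) m 0) n + 0#     ≈⟨ +-identityʳ _ ⟩
    1# * shift (s ℕ.* 0) (powCoeff (suc s) m 0) n          ≈⟨ *-identityˡ _ ⟩
    shift (s ℕ.* 0) (powCoeff (suc s) m 0) n               ≈⟨ shift-≡ _ n (ℕₚ.*-zeroʳ s) ⟩
    shift 0 (powCoeff (suc s) m 0) n                       ≈⟨ shift-≤ _ z≤n ⟩
    powCoeff s (suc m) 0 n                                 ∎)
  powCoeff-split s m (suc k) n = begin
    powCoeff s (suc m) (suc k) n
      ≈⟨ ∑-suc m _ ⟩
    x (s ℕ.+ 0) * shift (s ℕ.+ 0) Yk n + ∑ m (λ t → x (s ℕ.+ suc t) * shift (s ℕ.+ suc t) Yk n)
      ≈⟨ +-cong first-summand other-summands ⟩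
    ∑ (suc k) (λ a → (k C a) · g (suc a)) + ∑ (suc k) (λ a → (k C a) · (x s ^ a * shift (s ℕ.* a) (Y′ (suc (k ∸ a))) n))
      ≈⟨ +-congˡ (∑-cong (suc k) {g = λ a → (k C a) · g a} (λ a a≤k → ×-congʳ (k C a) (*-congˡ
           (reflexive (≡.cong (λ q → shift (s ℕ.* a) (Y′ q) n) (≡.sym (ℕₚ.+-∸-assoc 1 (ℕₚ.≤-pred a≤k)))))))) ⟩
    ∑ (suc k) (λ a → (k C a) · g (suc a)) + ∑ (suc k) (λ a → (k C a) · g a)
      ≈⟨ ∑-pascal k g ⟩
    ∑ (suc (suc k)) (λ a → (suc k C a) · g a) ∎
    where
    Yk : ℕ → Carrier
    Yk = powCoeff s (suc m) k
    Y′ : ℕ → ℕ → Carrier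
    Y′ = powCoeff (suc s) m
    g : ℕ → Carrier
    g a = x s ^ a * shift (s ℕ.* a) (Y′ (suc k ∸ a)) n

    shifted-split : ∀ i → shift i Yk n
                    ≈ ∑ (suc k) (λ a → (k C a) · (x s ^ a * shift (i ℕ.+ s ℕ.* a) (Y′ (k ∸ a)) n))
    shifted-split i = begin
      shift i Yk n
        ≈⟨ shift-cong i n (λ _ → powCoeff-split s m k (n ∸ i)) ⟩
      shift i (λ n′ → ∑ (suc k) (λ a → (k C a) · (x s ^ a * shift (s ℕ.* a) (Y′ (k ∸ a)) n′))) n
        ≈⟨ shift-∑ i (suc k) (λ a n′ → (k C a) · (x s ^ a * shift (s ℕ.* a) (Y′ (k ∸ a)) n′)) n ⟩
      ∑ (suc k) (λ a → shift i (λ n′ → (k C a) · (x s ^ a * shift (s ℕ.* a) (Y′ (k ∸ a)) n′)) n)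
        ≈⟨ ∑-cong (suc k) (λ a _ → trans (shift-homo i (λ z → (k C a) · (x s ^ a * z)) (×-*-zeroʳ (k C a) _) _ n)
             (×-congʳ (k C a) (*-congˡ (shift-+ i (s ℕ.* a) _ n)))) ⟩
      ∑ (suc k) (λ a → (k C a) · (x s ^ a * shift (i ℕ.+ s ℕ.* a) (Y′ (k ∸ a)) n)) ∎

    first-summand : x (s ℕ.+ 0) * shift (s ℕ.+ 0) Yk n ≈ ∑ (suc k) (λ a → (k C a) · g (suc a))
    first-summand = begin
      x (s ℕ.+ 0) * shift (s ℕ.+ 0) Yk n
        ≈⟨ trans (*-cong (reflexive (≡.cong x (ℕₚ.+-identityʳ s))) (shifted-split (s ℕ.+ 0))) (∑-distribˡ-* (suc k) _ _) ⟩
      ∑ (suc k) (λ a → x s * ((k C a) · (x s ^ a * shift (s ℕ.+ 0 ℕ.+ s ℕ.* a) (Y′ (k ∸ a)) n)))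
        ≈⟨ ∑-cong (suc k) (λ a _ → trans (*-×-*-comm (k C a) _ _ _) (×-congʳ (k C a)
             (trans (sym (*-assoc _ _ _)) (*-cong (*-comm _ _)
               (shift-≡ _ n (≡.trans (≡.cong (ℕ._+ s ℕ.* a) (ℕₚ.+-identityʳ s)) (≡.sym (ℕₚ.*-suc s a)))))))) ⟩
      ∑ (suc k) (λ a → (k C a) · g (suc a)) ∎

    reindex : ∀ a → ∑ m (λ t → x (s ℕ.+ suc t) * shift (s ℕ.+ suc t ℕ.+ s ℕ.* a) (Y′ (k ∸ a)) n)
                    ≈ shift (s ℕ.* a) (Y′ (suc (k ∸ a))) n
    reindex a = sym (begin
      shift (s ℕ.* a) (λ n′ → ∑ m (λ t → x (suc s ℕ.+ t) * shift (suc s ℕ.+ t) (Y′ (k ∸ a)) n′)) n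
        ≈⟨ shift-∑ (s ℕ.* a) m _ n ⟩
      ∑ m (λ t → shift (s ℕ.* a) (λ n′ → x (suc s ℕ.+ t) * shift (suc s ℕ.+ t) (Y′ (k ∸ a)) n′) n)
        ≈⟨ ∑-cong m (λ t _ → trans (shift-homo (s ℕ.* a) (x (suc s ℕ.+ t) *_) (zeroʳ _) _ n)
             (*-cong (reflexive (≡.cong x (≡.sym (ℕₚ.+-suc s t))))
               (trans (shift-+ (s ℕ.* a) (suc s ℕ.+ t) _ n) (shift-≡ _ n
                 (≡.trans (ℕₚ.+-comm (s ℕ.* a) (suc s ℕ.+ t)) (≡.cong (ℕ._+ s ℕ.* a) (≡.sym (ℕₚ.+-suc s t)))))))) ⟩
      ∑ m (λ t → x (s ℕ.+ suc t) * shift (s ℕ.+ suc t ℕ.+ s ℕ.* a) (Y′ (k ∸ a)) n) ∎)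

    other-summands : ∑ m (λ t → x (s ℕ.+ suc t) * shift (s ℕ.+ suc t) Yk n)
                    ≈ ∑ (suc k) (λ a → (k C a) · (x s ^ a * shift (s ℕ.* a) (Y′ (suc (k ∸ a))) n))
    other-summands = begin
      ∑ m (λ t → x (s ℕ.+ suc t) * shift (s ℕ.+ suc t) Yk n)
        ≈⟨ ∑-cong m (λ t _ → trans (*-congˡ (shifted-split (s ℕ.+ suc t)))
             (trans (∑-distribˡ-* (suc k) _ _) (∑-cong (suc k) (λ a _ → *-×-*-comm (k C a) _ _ _)))) ⟩
      ∑ m (λ t → ∑ (suc k) (λ a → (k C a) · (x s ^ a * (x (s ℕ.+ suc t) * shift (s ℕ.+ suc t ℕ.+ s ℕ.* a) (Y′ (k ∸ a)) n))))
        ≈⟨ ∑-comm m (suc k) _ ⟩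
      ∑ (suc k) (λ a → ∑ m (λ t → (k C a) · (x s ^ a * (x (s ℕ.+ suc t) * shift (s ℕ.+ suc t ℕ.+ s ℕ.* a) (Y′ (k ∸ a)) n))))
        ≈⟨ ∑-cong (suc k) (λ a _ → trans (sym (∑-distribˡ-× m (k C a) _))
             (×-congʳ (k C a) (trans (sym (∑-distribˡ-* m _ _)) (*-congˡ (reindex a))))) ⟩
      ∑ (suc k) (λ a → (k C a) · (x s ^ a * shift (s ℕ.* a) (Y′ (suc (k ∸ a))) n)) ∎

  inBellIndex : (s k n : ℕ) → ∀ {m} (js : Vec ℕ m) → Dec (vsum js ≡ k × wsumFrom s js ≡ n)
  inBellIndex s k n js = (vsum js ≟ k) ×-dec (wsumFrom s js ≟ n)

  bellSummand : (s k n : ℕ) → ∀ {m} → Vec ℕ m → Carrier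
  bellSummand s k n js = when (inBellIndex s k n js) (multinom k js · monoFrom x s js)

  bellSummand-∷-vanishes-k<j : ∀ s k n j {m} (js : Vec ℕ m) → k < j → bellSummand s k n (j ∷ js) ≈ 0#
  bellSummand-∷-vanishes-k<j s k n j js k<j with inBellIndex s k n (j ∷ js)
  ... | yes (vsum≡k , _) = ⊥-elim (ℕₚ.<⇒≱ k<j (≡.subst (j ≤_) vsum≡k (ℕₚ.m≤m+n j (vsum js))))
  ... | no  _            = refl

  bellSummand-∷-vanishes-n<sj : ∀ s k n j {m} (js : Vec ℕ m) → n < s ℕ.* j → bellSummand s k n (j ∷ js) ≈ 0#
  bellSummand-∷-vanishes-n<sj s k n j js n<sj with inBellIndex s k n (j ∷ js)
  ... | yes (_ , wsum≡n) = ⊥-elim (ℕₚ.<⇒≱ n<sj (≡.subst (s ℕ.* j ≤_) wsum≡n (ℕₚ.m≤m+n (s ℕ.* j) (wsumFrom (suc s) js))))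
  ... | no  _            = refl

  bellSummand-∷ : ∀ s k n j {m} (js : Vec ℕ m) → j ≤ k → s ℕ.* j ≤ n →
                  bellSummand s k n (j ∷ js) ≈ (k C j) · (x s ^ j * bellSummand (suc s) (k ∸ j) (n ∸ s ℕ.* j) js)
  bellSummand-∷ s k n j js j≤k sj≤n with inBellIndex s k n (j ∷ js) | inBellIndex (suc s) (k ∸ j) (n ∸ s ℕ.* j) js
  ... | yes _ | yes (vsum≡ , _) = begin
    multinom k (j ∷ js) · (x s ^ j * monoFrom x (suc s) js)
      ≈⟨ ×-congˡ (multinom-∷ k j js j≤k vsum≡) ⟩
    ((k C j) ℕ.* multinom (k ∸ j) js) · (x s ^ j * monoFrom x (suc s) js)
      ≈⟨ sym (×-assocˡ _ (k C j) (multinom (k ∸ j) js)) ⟩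
    (k C j) · (multinom (k ∸ j) js · (x s ^ j * monoFrom x (suc s) js))
      ≈⟨ ×-congʳ (k C j) (sym (×-comm-* (multinom (k ∸ j) js) (x s ^ j) _)) ⟩
    (k C j) · (x s ^ j * (multinom (k ∸ j) js · monoFrom x (suc s) js)) ∎
  ... | yes (vsum≡ , wsum≡) | no ∉ = ⊥-elim (∉
    ( ≡.trans (≡.sym (ℕₚ.m+n∸m≡n j (vsum js))) (≡.cong (_∸ j) vsum≡)
    , ≡.trans (≡.sym (ℕₚ.m+n∸m≡n (s ℕ.* j) (wsumFrom (suc s) js))) (≡.cong (_∸ s ℕ.* j) wsum≡)))
  ... | no ∉ | yes (vsum≡ , wsum≡) = ⊥-elim (∉
    ( ≡.trans (≡.cong (j ℕ.+_) vsum≡) (ℕₚ.m+[n∸m]≡n j≤k)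
    , ≡.trans (≡.cong (s ℕ.* j ℕ.+_) wsum≡) (ℕₚ.m+[n∸m]≡n sj≤n)))
  ... | no _ | no _ = sym (×-*-zeroʳ (k C j) _)

  bellSum : (s m b k n : ℕ) → Carrier
  bellSum s m b k n = Σ (map (bellSummand s k n) (tuples m b))

  bellSum≈powCoeff : ∀ m s b k n → k ≤ b → bellSum s m b k n ≈ powCoeff s m k n
  bellSum≈powCoeff zero s b zero    zero    _ = trans (+-identityʳ _) (+-identityʳ _)
  bellSum≈powCoeff zero s b zero    (suc n) _ = +-identityʳ _
  bellSum≈powCoeff zero s b (suc k) n       _ = trans (+-identityʳ _) (sym (∑-zero 0 (λ _ ())))
  bellSum≈powCoeff (suc m) s b k n k≤b = begin
    bellSum s (suc m) b k n
      ≈⟨ Σ-map-concatMap (bellSummand s k n) (λ j → map (j ∷_) (tuples m b)) (upTo (suc b)) ⟩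
    Σ (map (λ j → Σ (map (bellSummand s k n) (map (j ∷_) (tuples m b)))) (upTo (suc b)))
      ≈⟨ Σ-map-upTo (suc b) _ ⟩
    ∑ (suc b) (λ j → Σ (map (bellSummand s k n) (map (j ∷_) (tuples m b))))
      ≈⟨ ∑-cong (suc b) (λ j _ → reflexive (≡.cong Σ (≡.sym (map-∘ (tuples m b))))) ⟩
    ∑ (suc b) headSum
      ≈⟨ reflexive (≡.cong (λ N → ∑ N headSum) (≡.sym (≡.cong suc (ℕₚ.m+[n∸m]≡n k≤b)))) ⟩
    ∑ (suc k ℕ.+ (b ∸ k)) headSum
      ≈⟨ ∑-trailing-zeros (suc k) (b ∸ k) headSum
           (λ j k<j → Σ-zero (tuples m b) (λ js → bellSummand-∷-vanishes-k<j s k n j js k<j)) ⟩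
    ∑ (suc k) headSum
      ≈⟨ ∑-cong (suc k) (λ a a<sk → headSum≈ a (ℕₚ.≤-pred a<sk)) ⟩
    ∑ (suc k) (λ a → (k C a) · (x s ^ a * shift (s ℕ.* a) (powCoeff (suc s) m (k ∸ a)) n))
      ≈⟨ sym (powCoeff-split s m k n) ⟩
    powCoeff s (suc m) k n ∎
    where
    headSum : ℕ → Carrier
    headSum j = Σ (map (λ js → bellSummand s k n (j ∷ js)) (tuples m b))

    headSum≈ : ∀ a → a ≤ k → headSum a ≈ (k C a) · (x s ^ a * shift (s ℕ.* a) (powCoeff (suc s) m (k ∸ a)) n)
    headSum≈ a a≤k with s ℕ.* a ≤? n
    ... | yes sa≤n = begin
      headSum a
        ≈⟨ Σ-cong (tuples m b) (λ js → bellSummand-∷ s k n a js a≤k sa≤n) ⟩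
      Σ (map (λ js → (k C a) · (x s ^ a * bellSummand (suc s) (k ∸ a) (n ∸ s ℕ.* a) js)) (tuples m b))
        ≈⟨ sym (Σ-homo (λ z → (k C a) · (x s ^ a * z)) (×-*-zeroʳ (k C a) _)
             (λ u v → trans (×-congʳ (k C a) (distribˡ _ _ _)) (×-distrib-+ _ _ (k C a))) _ (tuples m b)) ⟩
      (k C a) · (x s ^ a * bellSum (suc s) m b (k ∸ a) (n ∸ s ℕ.* a))
        ≈⟨ ×-congʳ (k C a) (*-congˡ (trans (bellSum≈powCoeff m (suc s) b (k ∸ a) (n ∸ s ℕ.* a)
             (ℕₚ.≤-trans (ℕₚ.m∸n≤m k a) k≤b)) (sym (shift-≤ _ sa≤n)))) ⟩
      (k C a) · (x s ^ a * shift (s ℕ.* a) (powCoeff (suc s) m (k ∸ a)) n) ∎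
    ... | no sa≰n = trans (Σ-zero (tuples m b) (λ js → bellSummand-∷-vanishes-n<sj s k n a js (ℕₚ.≰⇒> sa≰n)))
                          (sym (trans (×-congʳ (k C a) (*-congˡ (shift-≰ _ sa≰n))) (×-*-zeroʳ (k C a) _)))

  bellPartial≈powCoeff : ∀ n k → bellPartial n k x ≈ powCoeff 1 (suc (n ∸ k)) k n
  bellPartial≈powCoeff n k =
    trans (Σ-map-filter (inBellIndex 1 k n) (λ js → multinom k js · monoFrom x 1 js) (tuples (suc (n ∸ k)) k))
          (bellSum≈powCoeff (suc (n ∸ k)) 1 k k n ℕₚ.≤-refl)

  powCoeff-vanishes : ∀ m k n → n < k → powCoeff 1 m k n ≈ 0#
  powCoeff-vanishes m (suc k) n n<k = ∑-zero m (λ t _ → trans (*-congˡ (trans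
    (shift-cong (suc t) n (λ st≤n → powCoeff-vanishes m k (n ∸ suc t) (∸-suc-< t st≤n n<k)))
    (shift-zero (suc t) n))) (zeroʳ _))

  powCoeff-stable : ∀ m k n → n < k ℕ.+ m → powCoeff 1 m k n ≈ powCoeff 1 (suc m) k n
  powCoeff-stable m zero    n _    = refl
  powCoeff-stable m (suc k) n n<k+m = sym (begin
    ∑ (suc m) summand′
      ≈⟨ ∑-last m summand′ ⟩
    ∑ m summand′ + summand′ m
      ≈⟨ +-cong (∑-cong m (λ t _ → *-congˡ (shift-cong (suc t) n (λ st≤n →
           sym (powCoeff-stable m k (n ∸ suc t) (∸-suc-< t st≤n n<k+m)))))) last≈0 ⟩
    ∑ m summand + 0#
      ≈⟨ +-identityʳ _ ⟩
    ∑ m summand ∎)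
    where
    summand summand′ : ℕ → Carrier
    summand  t = x (suc t) * shift (suc t) (powCoeff 1 m k) n
    summand′ t = x (suc t) * shift (suc t) (powCoeff 1 (suc m) k) n
    last≈0 : summand′ m ≈ 0#
    last≈0 = trans (*-congˡ (trans (shift-cong (suc m) n (λ sm≤n → powCoeff-vanishes (suc m) k (n ∸ suc m)
               (∸-<-+ sm≤n (≡.subst (n <_) (≡.sym (ℕₚ.+-suc k m)) n<k+m))))
             (shift-zero (suc m) n))) (zeroʳ _)

  powCoeff-stable-+ : ∀ d m k n → n < k ℕ.+ m → powCoeff 1 m k n ≈ powCoeff 1 (d ℕ.+ m) k n
  powCoeff-stable-+ zero    m k n _     = refl
  powCoeff-stable-+ (suc d) m k n n<k+m = trans (powCoeff-stable-+ d m k n n<k+m)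
    (powCoeff-stable (d ℕ.+ m) k n (ℕₚ.<-≤-trans n<k+m (ℕₚ.+-monoʳ-≤ k (ℕₚ.m≤n+m m d))))

  bellComplete≈∑powCoeff : ∀ n → bellComplete n x ≈ ∑ n (λ i → powCoeff 1 n (suc i) n)
  bellComplete≈∑powCoeff n = trans (Σ-map-upTo n _) (∑-cong n (λ i i<n →
    trans (bellPartial≈powCoeff n (suc i))
          (trans (powCoeff-stable-+ i (suc (n ∸ suc i)) (suc i) n (n<1+i+len i<n))
                 (reflexive (≡.cong (λ m → powCoeff 1 m (suc i) n) (i+len≡n i<n))))))
    where
    i+len≡n : ∀ {i} → i < n → i ℕ.+ suc (n ∸ suc i) ≡ n
    i+len≡n {i} i<n = ≡.trans (ℕₚ.+-suc i (n ∸ suc i)) (ℕₚ.m+[n∸m]≡n i<n)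
    n<1+i+len : ∀ {i} → i < n → n < suc i ℕ.+ suc (n ∸ suc i)
    n<1+i+len i<n = ≡.subst (n <_) (≡.cong suc (≡.sym (i+len≡n i<n))) (ℕₚ.n<1+n n)

module Fibonacci {c ℓ : Level} (R : CommutativeSemiring c ℓ)
                 (x : ℕ → CommutativeSemiring.Carrier R) (r : ℕ) where
  open CommutativeSemiring R hiding (zero)
  open Poly R
  open Sums R
  open PowerCoefficients R x
  open import Relation.Binary.Reasoning.Setoid setoid

  F : ℕ → Carrier
  F m = fib r m x

  history-lookup : (A : ℕ → ℕ → Carrier) → (∀ m → A m 0 ≡ F m) → (∀ m i → A (suc m) (suc i) ≡ A m i) →
                   (∀ i → A 0 (suc i) ≡ 0#) → ∀ m i → A m i ≈ shift i F m
  history-lookup A head tail nil m       zero    = trans (reflexive (head m)) (sym (shift-≤ F z≤n))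
  history-lookup A head tail nil zero    (suc i) = trans (reflexive (nil i)) (sym (shift-≰ F (λ ())))
  history-lookup A head tail nil (suc m) (suc i) =
    trans (reflexive (tail m i)) (trans (history-lookup A head tail nil m i) (sym (shift-suc i F m)))

  mutual
    -- Defs' private lookup into `hist`, recovered as the solution of a unification problem in fib-rec.
    lookup : ℕ → ℕ → Carrier
    lookup = _

    fib-rec : ∀ m → r ≤ suc m → F (suc m) ≈ ∑ r (λ i → x (suc i) * shift i F m)
    fib-rec m r≤1+m with suc m <? r ∸ 1 | suc m ≟ r ∸ 1
    ... | yes 1+m<r∸1 | _        = ⊥-elim (ℕₚ.<⇒≱ 1+m<r∸1 (ℕₚ.m≤n⇒m≤1+n (ℕₚ.∸-monoˡ-≤ 1 r≤1+m)))
    ... | no _        | yes 1+m≡ = ⊥-elim (ℕₚ.1+n≰n (≡.subst (_≤ m) (≡.sym 1+m≡) (ℕₚ.∸-monoˡ-≤ 1 r≤1+m)))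
    ... | no _        | no _     = trans (Σ-map-upTo r _) (∑-cong r (λ i _ → *-congˡ
      (history-lookup lookup (λ _ → ≡.refl) (λ _ _ → ≡.refl) (λ _ → ≡.refl) m i)))

  fib-below : ∀ m → m < r ∸ 1 → F m ≈ 0#
  fib-below zero m<r∸1 with 0 <? r ∸ 1
  ... | yes _  = refl
  ... | no m≮ = ⊥-elim (m≮ m<r∸1)
  fib-below (suc m) m<r∸1 with suc m <? r ∸ 1
  ... | yes _  = refl
  ... | no m≮ = ⊥-elim (m≮ m<r∸1)

  fib-at : ∀ m → m ≡ r ∸ 1 → F m ≈ 1#
  fib-at zero m≡ with 0 <? r ∸ 1 | 0 ≟ r ∸ 1
  ... | yes m< | _     = ⊥-elim (ℕₚ.<-irrefl m≡ m<)
  ... | no _   | yes _ = refl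
  ... | no _   | no m≢ = ⊥-elim (m≢ m≡)
  fib-at (suc m) m≡ with suc m <? r ∸ 1 | suc m ≟ r ∸ 1
  ... | yes m< | _     = ⊥-elim (ℕₚ.<-irrefl m≡ m<)
  ... | no _   | yes _ = refl
  ... | no _   | no m≢ = ⊥-elim (m≢ m≡)

  fibFrom : ℕ → Carrier
  fibFrom j = F (r ∸ 1 ℕ.+ j)

  fibFrom-rec : ∀ j → fibFrom (suc j) ≈ ∑ r (λ t → x (suc t) * shift (suc t) fibFrom (suc j))
  fibFrom-rec j = begin
    fibFrom (suc j)                                ≈⟨ reflexive (≡.cong F (ℕₚ.+-suc (r ∸ 1) j)) ⟩
    F (suc (r ∸ 1 ℕ.+ j))                          ≈⟨ fib-rec (r ∸ 1 ℕ.+ j) (ℕₚ.≤-trans (ℕₚ.m≤n+m∸n r 1) (s≤s (ℕₚ.m≤m+n (r ∸ 1) j))) ⟩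
    ∑ r (λ t → x (suc t) * shift t F (r ∸ 1 ℕ.+ j)) ≈⟨ ∑-cong r (λ t _ → *-congˡ (shift-F≈shift-fibFrom t)) ⟩
    ∑ r (λ t → x (suc t) * shift (suc t) fibFrom (suc j)) ∎
    where
    shift-F≈shift-fibFrom : ∀ t → shift t F (r ∸ 1 ℕ.+ j) ≈ shift (suc t) fibFrom (suc j)
    shift-F≈shift-fibFrom t with t ≤? j
    ... | yes t≤j = trans (shift-≤ F (ℕₚ.≤-trans t≤j (ℕₚ.m≤n+m j (r ∸ 1))))
                          (trans (reflexive (≡.cong F (ℕₚ.+-∸-assoc (r ∸ 1) t≤j))) (sym (shift-≤ fibFrom (s≤s t≤j))))
    ... | no t≰j = trans below (sym (shift-≰ fibFrom (t≰j ∘ ℕₚ.≤-pred)))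
      where
      below : shift t F (r ∸ 1 ℕ.+ j) ≈ 0#
      below with t ≤? r ∸ 1 ℕ.+ j
      ... | yes t≤ = trans (shift-≤ F t≤) (fib-below _ (∸-<-+ t≤ (ℕₚ.+-monoʳ-< (r ∸ 1) (ℕₚ.≰⇒> t≰j))))
      ... | no t≰ = shift-≰ F t≰

  coeffSum : ℕ → Carrier
  coeffSum j = ∑ (suc j) (λ k → powCoeff 1 r k j)

  coeffSum-suc : ∀ j → coeffSum (suc j) ≈ ∑ (suc j) (λ k → powCoeff 1 r (suc k) (suc j))
  coeffSum-suc j = trans (∑-suc (suc j) _) (+-identityˡ _)

  coeffSum-rec : ∀ j → coeffSum (suc j) ≈ ∑ r (λ t → x (suc t) * shift (suc t) coeffSum (suc j))
  coeffSum-rec j = begin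
    coeffSum (suc j)
      ≈⟨ coeffSum-suc j ⟩
    ∑ (suc j) (λ k → ∑ r (λ t → x (suc t) * shift (suc t) (powCoeff 1 r k) (suc j)))
      ≈⟨ ∑-comm (suc j) r _ ⟩
    ∑ r (λ t → ∑ (suc j) (λ k → x (suc t) * shift (suc t) (powCoeff 1 r k) (suc j)))
      ≈⟨ ∑-cong r (λ t _ → trans (sym (∑-distribˡ-* (suc j) _ _)) (*-congˡ (∑-shift≈shift-coeffSum t))) ⟩
    ∑ r (λ t → x (suc t) * shift (suc t) coeffSum (suc j)) ∎
    where
    ∑-shift≈shift-coeffSum : ∀ t → ∑ (suc j) (λ k → shift (suc t) (powCoeff 1 r k) (suc j)) ≈ shift (suc t) coeffSum (suc j)
    ∑-shift≈shift-coeffSum t with t ≤? j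
    ... | yes t≤j = begin
      ∑ (suc j) (λ k → shift (suc t) (powCoeff 1 r k) (suc j))
        ≈⟨ ∑-cong (suc j) (λ k _ → shift-≤ (powCoeff 1 r k) (s≤s t≤j)) ⟩
      ∑ (suc j) (λ k → powCoeff 1 r k (j ∸ t))
        ≈⟨ reflexive (≡.cong (λ N → ∑ (suc N) (λ k → powCoeff 1 r k (j ∸ t))) (≡.sym (ℕₚ.m∸n+n≡m t≤j))) ⟩
      ∑ (suc (j ∸ t) ℕ.+ t) (λ k → powCoeff 1 r k (j ∸ t))
        ≈⟨ ∑-trailing-zeros (suc (j ∸ t)) t _ (λ k j∸t<k → powCoeff-vanishes r k (j ∸ t) j∸t<k) ⟩
      coeffSum (j ∸ t)
        ≈⟨ sym (shift-≤ coeffSum (s≤s t≤j)) ⟩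
      shift (suc t) coeffSum (suc j) ∎
    ... | no t≰j = trans (∑-zero (suc j) (λ k _ → shift-≰ (powCoeff 1 r k) (t≰j ∘ ℕₚ.≤-pred)))
                         (sym (shift-≰ coeffSum (t≰j ∘ ℕₚ.≤-pred)))

  fibFrom≈coeffSum : ∀ j → fibFrom j ≈ coeffSum j
  fibFrom≈coeffSum = <-rec (λ j → fibFrom j ≈ coeffSum j) step
    where
    step : ∀ j → (∀ {i} → i < j → fibFrom i ≈ coeffSum i) → fibFrom j ≈ coeffSum j
    step zero    _  = trans (fib-at (r ∸ 1 ℕ.+ 0) (ℕₚ.+-identityʳ (r ∸ 1))) (sym (∑-one _))
    step (suc j) ih = begin
      fibFrom (suc j)
        ≈⟨ fibFrom-rec j ⟩
      ∑ r (λ t → x (suc t) * shift (suc t) fibFrom (suc j))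
        ≈⟨ ∑-cong r (λ t _ → *-congˡ (shift-cong (suc t) (suc j) (λ _ → ih (s≤s (ℕₚ.m∸n≤m j t))))) ⟩
      ∑ r (λ t → x (suc t) * shift (suc t) coeffSum (suc j))
        ≈⟨ sym (coeffSum-rec j) ⟩
      coeffSum (suc j) ∎

theorem5p3 : {c ℓ : Level} (R : CommutativeSemiring c ℓ) (n : ℕ) → n ≥ 1 →
    (x : ℕ → CommutativeSemiring.Carrier R) →
    CommutativeSemiring._≈_ R (Poly.bellComplete R n x) (Poly.fib R n (2 ℕ.* n ∸ 1) x)
theorem5p3 R (suc n) _ x = begin
  bellComplete (suc n) x                                 ≈⟨ bellComplete≈∑powCoeff (suc n) ⟩
  ∑ (suc n) (λ i → powCoeff 1 (suc n) (suc i) (suc n))  ≈⟨ sym (coeffSum-suc n) ⟩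
  coeffSum (suc n)                                       ≈⟨ sym (fibFrom≈coeffSum (suc n)) ⟩
  F (n ℕ.+ suc n)                                        ≡⟨ ≡.cong (λ m → F (n ℕ.+ m)) (≡.sym (ℕₚ.+-identityʳ (suc n))) ⟩
  F (2 ℕ.* suc n ∸ 1)                                    ∎
  where
  open CommutativeSemiring R using (sym)
  open Poly R using (bellComplete)
  open Sums R using (∑)
  open PowerCoefficients R x using (powCoeff; bellComplete≈∑powCoeff)
  open Fibonacci R x (suc n) using (F; coeffSum; coeffSum-suc; fibFrom≈coeffSum)
  open import Relation.Binary.Reasoning.Setoid (CommutativeSemiring.setoid R)
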